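{- Let $V$ be a vertex set with $|V|=n\ge 2$ and let $G$ be the disjoint union of $n-1$ spanning arborescences $A_1,\dots,A_{n-1}$ on $V$, each of which is a path. Then $G$ has a rainbow spanning arborescence.
   Context: An arborescence is a connected digraph in which exactly one vertex (the root) has no incoming arc and every other vertex has exactly one incoming arc; it is spanning on $V$ if its vertex set is $V$. A path is an arborescence with exactly one leaf (vertex with no outgoing arc). $G$ is the disjoint union of the arc sets $A_i$ (parallel arcs of different indices allowed). A subgraph $B$ of $G$ is rainbow if $|B\cap A_i|\le 1$ for all $i$. -}

module Defs where

open import Data.Nat using (ℕ; _∸_; _≤_)
open import Data.Fin using (Fin; _≟_)
open import Data.Product using (_×_; _,_; proj₁; proj₂; ∃; ∃-syntax)
open import Data.Sum using (_⊎_)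
open import Data.List using (List; length; filter; map)
open import Data.List.Membership.Propositional using (_∈_)
open import Data.List.Relation.Unary.All using (All)
open import Data.List.Relation.Unary.Unique.Propositional using (Unique)
open import Relation.Binary.PropositionalEquality using (_≡_; _≢_)
open import Relation.Binary.Construct.Closure.ReflexiveTransitive using (Star)

-- An arc on vertex set Fin n: (tail , head).
Arc : ℕ → Set
Arc n = Fin n × Fin n

Digraph : ℕ → Set
Digraph n = List (Arc n)

indeg : ∀ {n} → Digraph n → Fin n → ℕ
indeg D v = length (filter (λ a → proj₂ a ≟ v) D)

outdeg : ∀ {n} → Digraph n → Fin n → ℕ
outdeg D v = length (filter (λ a → proj₁ a ≟ v) D)

Adjacent : ∀ {n} → Digraph n → Fin n → Fin n → Set
Adjacent D u v = ((u , v) ∈ D) ⊎ ((v , u) ∈ D)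

Connected : ∀ {n} → Digraph n → Set
Connected D = ∀ u v → Star (Adjacent D) u v

IsSpanningArborescence : ∀ {n} → Digraph n → Set
IsSpanningArborescence {n} D =
  Connected D × (∃[ r ] (indeg D r ≡ 0 × (∀ v → v ≢ r → indeg D v ≡ 1)))

IsLeaf : ∀ {n} → Digraph n → Fin n → Set
IsLeaf D v = outdeg D v ≡ 0

-- a path: an arborescence with exactly one leaf
IsPath : ∀ {n} → Digraph n → Set
IsPath {n} D = ∃[ l ] (IsLeaf D l × (∀ v → IsLeaf D v → v ≡ l))

-- A subgraph of G = disjoint union of the A_i, given as a list of indexed arcs (i , a)
-- with a ∈ A_i.  It is rainbow if each index occurs at most once.
Subgraph : ∀ {n k} → (Fin k → Digraph n) → List (Fin k × Arc n) → Set
Subgraph A B = All (λ ia → proj₂ ia ∈ A (proj₁ ia)) B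

Rainbow : ∀ {n k} → List (Fin k × Arc n) → Set
Rainbow B = Unique (map proj₁ B)

underlying : ∀ {n k} → List (Fin k × Arc n) → Digraph n
underlying B = map proj₂ B

-- Write n = k + 1, so that there are k colours. Along the path A c, reachability totally orders
-- the vertices. Giving each colour in turn the last still unassigned vertex in its order leaves
-- one vertex r that lies before the vertex t c assigned to c, for every c; t is a bijection onto
-- the vertices other than r. A tree is then grown from r, each colour c that is still pending
-- keeping a walk in A c from the tree to t c. If some pending c has an arc of A c from the tree
-- to t c, that arc is attached. Otherwise the last arc of each such walk starts at t c′ for
-- another pending colour c′; following c ↦ c′ until it cycles and letting each colour on the
-- cycle take over the target of its successor keeps t bijective and shortens those walks.
-- The total length of the walks decreases, so eventually every colour is attached, and the
-- k arcs form a rainbow spanning arborescence rooted at r.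
{-# OPTIONS --safe #-}
module Submission where

open import Defs
open import Algebra.Properties.CommutativeSemigroup using (interchange)
open import Data.Empty using (⊥-elim)
open import Data.Fin using (Fin; zero; suc; _≟_; punchIn; punchOut; toℕ)
open import Data.Fin.Properties using (punchIn-injective; punchInᵢ≢i; punchIn-punchOut; pigeonhole; any?)
open import Data.List using (List; []; _∷_; length; filter; map; allFin)
open import Data.List.Properties using (filter-none; filter-some; map-∘)
open import Data.List.Membership.Propositional using (_∈_)
open import Data.List.Membership.Propositional.Properties using (∈-filter⁺; ∈-map⁺; ∈-map⁻; ∈-allFin)
import Data.List.Relation.Unary.All as All
import Data.List.Relation.Unary.All.Properties as All
open import Data.List.Relation.Unary.AllPairs using (_∷_)
import Data.List.Relation.Unary.Any as Any
open Any using (here; there)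
open import Data.List.Relation.Unary.Unique.Propositional using (Unique)
open import Data.List.Relation.Unary.Unique.Propositional.Properties as UniqueProps using (allFin⁺)
open import Data.Nat using (ℕ; zero; suc; _+_; _∸_; _≤_; _<_; z≤n; s≤s)
open import Data.Nat.Induction using (<-wellFounded)
open import Data.Nat.Properties
  using (+-commutativeSemigroup; +-comm; +-mono-≤; +-mono-<-≤; +-mono-≤-<; ≤-reflexive; ≤-trans;
         ≮⇒≥; <-irrefl; <⇒≤; m≤m+n; m≤n+m; n<1+n; m≤n⇒∃[o]m+o≡n)
open import Data.Product using (_×_; _,_; proj₁; proj₂; ∃; ∃₂; ∃-syntax)
open import Data.Product.Properties using (≡-dec)
open import Data.Sum using (_⊎_; inj₁; inj₂; reduce; swap)
import Data.Vec.Functional as Vector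
open Vector using (updateAt)
open import Data.Vec.Functional.Properties using (updateAt-updates; updateAt-minimal)
open import Function.Base using (id; _∘_; flip; _on_)
import Function.Endo.Propositional
open import Induction.WellFounded using (Acc; acc)
open import Level using (0ℓ)
open import Relation.Binary.Core using (Rel)
open import Relation.Binary.Definitions using (Total; Transitive; DecidableEquality)
import Relation.Binary.Construct.On as On
open import Relation.Binary.Construct.Closure.ReflexiveTransitive as Star using (Star; ε; _◅_; _◅◅_; reverse)
open import Relation.Binary.PropositionalEquality
  using (_≡_; _≢_; refl; sym; trans; cong; cong₂; cong-app; subst; subst₂)
open import Relation.Binary.PropositionalEquality.Properties using (module ≡-Reasoning)
open import Relation.Nullary using (¬_; Dec; yes; no)
open import Relation.Nullary.Decidable using (_×-dec_; _⊎-dec_)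
open import Relation.Unary using (Pred; Decidable)

-- Finite sums

∑ : ∀ {n} → (Fin n → ℕ) → ℕ
∑ {zero}  f = 0
∑ {suc n} f = f zero + ∑ (λ i → f (suc i))

∑-cong : ∀ {n} {f g : Fin n → ℕ} → (∀ i → f i ≡ g i) → ∑ f ≡ ∑ g
∑-cong {zero}  f≡g = refl
∑-cong {suc n} f≡g = cong₂ _+_ (f≡g zero) (∑-cong (λ i → f≡g (suc i)))

∑-distrib-+ : ∀ {n} (f g : Fin n → ℕ) → ∑ (λ i → f i + g i) ≡ ∑ f + ∑ g
∑-distrib-+ {zero}  f g = refl
∑-distrib-+ {suc n} f g = begin
  (f zero + g zero) + ∑ (λ i → f (suc i) + g (suc i))
    ≡⟨ cong (f zero + g zero +_) (∑-distrib-+ (λ i → f (suc i)) (λ i → g (suc i))) ⟩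
  (f zero + g zero) + (∑ (λ i → f (suc i)) + ∑ (λ i → g (suc i)))
    ≡⟨ interchange +-commutativeSemigroup (f zero) (g zero) _ _ ⟩
  ∑ f + ∑ g ∎
  where open ≡-Reasoning

∑-mono-≤ : ∀ {n} {f g : Fin n → ℕ} → (∀ i → f i ≤ g i) → ∑ f ≤ ∑ g
∑-mono-≤ {zero}  f≤g = z≤n
∑-mono-≤ {suc n} f≤g = +-mono-≤ (f≤g zero) (∑-mono-≤ (λ i → f≤g (suc i)))

∑-mono-< : ∀ {n} {f g : Fin n → ℕ} → (∀ i → f i ≤ g i) → ∀ j → f j < g j → ∑ f < ∑ g
∑-mono-< f≤g zero    fj<gj = +-mono-<-≤ fj<gj (∑-mono-≤ (λ i → f≤g (suc i)))
∑-mono-< f≤g (suc j) fj<gj = +-mono-≤-< (f≤g zero) (∑-mono-< (λ i → f≤g (suc i)) j fj<gj)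

∑-one : ∀ n → ∑ {n} (λ _ → 1) ≡ n
∑-one zero    = refl
∑-one (suc n) = cong suc (∑-one n)

δ : ∀ {n} → Fin n → Fin n → ℕ
δ zero    zero    = 1
δ zero    (suc _) = 0
δ (suc _) zero    = 0
δ (suc x) (suc y) = δ x y

δ-refl : ∀ {n} (x : Fin n) → δ x x ≡ 1
δ-refl zero    = refl
δ-refl (suc x) = δ-refl x

δ-≢ : ∀ {n} {x y : Fin n} → x ≢ y → δ x y ≡ 0
δ-≢ {x = zero}  {zero}  x≢y = ⊥-elim (x≢y refl)
δ-≢ {x = zero}  {suc _} _   = refl
δ-≢ {x = suc _} {zero}  _   = refl
δ-≢ {x = suc x} {suc y} x≢y = δ-≢ (λ x≡y → x≢y (cong suc x≡y))

∑-zero : ∀ n → ∑ {n} (λ _ → 0) ≡ 0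
∑-zero zero    = refl
∑-zero (suc n) = ∑-zero n

∑-δ : ∀ {n} (x : Fin n) → ∑ (δ x) ≡ 1
∑-δ {suc n} zero    = cong suc (∑-zero n)
∑-δ {suc n} (suc x) = ∑-δ x

module _ {A : Set} {n : ℕ} (g : A → Fin n) where

  private
    count : List A → Fin n → ℕ
    count xs v = length (filter (λ a → g a ≟ v) xs)

    count-∷ : ∀ x xs v → count (x ∷ xs) v ≡ δ (g x) v + count xs v
    count-∷ x xs v with g x ≟ v
    ... | yes refl rewrite δ-refl v = refl
    ... | no gx≢v  rewrite δ-≢ gx≢v = refl

  ∑-count : ∀ xs → ∑ (λ v → length (filter (λ a → g a ≟ v) xs)) ≡ length xs
  ∑-count []       = ∑-zero n
  ∑-count (x ∷ xs) = begin
    ∑ (count (x ∷ xs))                 ≡⟨ ∑-cong (count-∷ x xs) ⟩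
    ∑ (λ v → δ (g x) v + count xs v)   ≡⟨ ∑-distrib-+ (δ (g x)) (count xs) ⟩
    ∑ (δ (g x)) + ∑ (count xs)         ≡⟨ cong₂ _+_ (∑-δ (g x)) (∑-count xs) ⟩
    suc (length xs)                    ∎
    where open ≡-Reasoning

∈-length≤1⇒≡ : ∀ {A : Set} {xs : List A} {x y} → length xs ≤ 1 → x ∈ xs → y ∈ xs → x ≡ y
∈-length≤1⇒≡ {xs = _ ∷ []}    _         (here refl) (here refl) = refl
∈-length≤1⇒≡ {xs = _ ∷ _ ∷ _} (s≤s ()) _           _

module _ {A : Set} {P : Pred A 0ℓ} (P? : Decidable P) where

  length-filter-unique : ∀ {xs x} → Unique xs → x ∈ xs → P x →
                         (∀ {y} → y ∈ xs → P y → y ≡ x) → length (filter P? xs) ≡ 1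
  length-filter-unique {y ∷ ys} (y∉ys ∷ ys-unique) x∈xs Px only-x with P? y
  ... | yes Py = cong suc (cong length (filter-none P? (All.tabulate ¬P)))
    where
    ¬P : ∀ {z} → z ∈ ys → ¬ P z
    ¬P z∈ys Pz = All.lookup y∉ys z∈ys (trans (only-x (here refl) Py) (sym (only-x (there z∈ys) Pz)))
  ... | no ¬Py with x∈xs
  ...   | here refl  = ⊥-elim (¬Py Px)
  ...   | there x∈ys = length-filter-unique ys-unique x∈ys Px (λ y∈ys → only-x (there y∈ys))

-- Path arborescences

HasArc : ∀ {n} → Digraph n → Fin n → Fin n → Set
HasArc D x y = (x , y) ∈ D

Reaches : ∀ {n} → Digraph n → Fin n → Fin n → Set
Reaches D = Star (HasArc D)

module PathArborescence {n} {D : Digraph n} (arborescence : IsSpanningArborescence D) (path : IsPath D) where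

  private
    connected : Connected D
    connected = proj₁ arborescence

    root : Fin n
    root = proj₁ (proj₂ arborescence)

    indeg-root : indeg D root ≡ 0
    indeg-root = proj₁ (proj₂ (proj₂ arborescence))

    indeg-nonroot : ∀ v → v ≢ root → indeg D v ≡ 1
    indeg-nonroot = proj₂ (proj₂ (proj₂ arborescence))

    leaf : Fin n
    leaf = proj₁ path

    leaf-unique : ∀ v → outdeg D v ≡ 0 → v ≡ leaf
    leaf-unique = proj₂ (proj₂ path)

  indeg≤1 : ∀ v → indeg D v ≤ 1
  indeg≤1 v with v ≟ root
  ... | yes refl  = ≤-trans (≤-reflexive indeg-root) z≤n
  ... | no v≢root = ≤-reflexive (indeg-nonroot v v≢root)

  private
    indeg+δ≡1 : ∀ v → indeg D v + δ root v ≡ 1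
    indeg+δ≡1 v with v ≟ root
    ... | yes refl  rewrite indeg-root | δ-refl root = refl
    ... | no v≢root rewrite indeg-nonroot v v≢root | δ-≢ (v≢root ∘ sym) = refl

    outdeg+δ≥1 : ∀ v → 1 ≤ outdeg D v + δ leaf v
    outdeg+δ≥1 v with v ≟ leaf
    ... | yes refl rewrite δ-refl leaf = m≤n+m 1 (outdeg D leaf)
    ... | no v≢leaf with outdeg D v in eq
    ...   | zero  = ⊥-elim (v≢leaf (leaf-unique v eq))
    ...   | suc _ = s≤s z≤n

    ∑-outdeg+δ : ∑ (λ v → outdeg D v + δ leaf v) ≡ n
    ∑-outdeg+δ = begin
      ∑ (λ v → outdeg D v + δ leaf v)  ≡⟨ ∑-distrib-+ (outdeg D) (δ leaf) ⟩
      ∑ (outdeg D) + ∑ (δ leaf)        ≡⟨ cong₂ _+_ (∑-count proj₁ D) (∑-δ leaf) ⟩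
      length D + 1                     ≡⟨ cong₂ _+_ (∑-count proj₂ D) (∑-δ root) ⟨
      ∑ (indeg D) + ∑ (δ root)         ≡⟨ ∑-distrib-+ (indeg D) (δ root) ⟨
      ∑ (λ v → indeg D v + δ root v)   ≡⟨ ∑-cong indeg+δ≡1 ⟩
      ∑ {n} (λ _ → 1)                  ≡⟨ ∑-one n ⟩
      n                                ∎
      where open ≡-Reasoning

  -- Every vertex but the leaf has an out-arc and there are only n - 1 arcs.
  outdeg≤1 : ∀ v → outdeg D v ≤ 1
  outdeg≤1 v = ≮⇒≥ λ 1<outdeg → <-irrefl (trans (∑-one n) (sym ∑-outdeg+δ))
    (∑-mono-< outdeg+δ≥1 v (≤-trans 1<outdeg (m≤m+n (outdeg D v) (δ leaf v))))

  successor-unique : ∀ {x y z} → HasArc D x y → HasArc D x z → y ≡ z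
  successor-unique {x} xy xz = cong proj₂ (∈-length≤1⇒≡ (outdeg≤1 x)
    (∈-filter⁺ (λ a → proj₁ a ≟ x) xy refl) (∈-filter⁺ (λ a → proj₁ a ≟ x) xz refl))

  predecessor-unique : ∀ {x y z} → HasArc D x z → HasArc D y z → x ≡ y
  predecessor-unique {z = z} xz yz = cong proj₁ (∈-length≤1⇒≡ (indeg≤1 z)
    (∈-filter⁺ (λ a → proj₂ a ≟ z) xz refl) (∈-filter⁺ (λ a → proj₂ a ≟ z) yz refl))

  no-arc-into-root : ∀ {x} → ¬ HasArc D x root
  no-arc-into-root xr = <-irrefl (sym indeg-root)
    (filter-some (λ a → proj₂ a ≟ root) (Any.map (λ eq → cong proj₂ (sym eq)) xr))

  private
    -- An undirected walk from the root is turned into a directed one (kept reversed):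
    -- a backward step can only retrace the last arc, the unique arc into the current vertex.
    retrace : ∀ {x y} → Star (flip (HasArc D)) x root → Star (Adjacent D) x y → Star (flip (HasArc D)) y root
    retrace back ε                = back
    retrace back (inj₁ xz ◅ walk) = retrace (xz ◅ back) walk
    retrace ε    (inj₂ zr ◅ walk) = ⊥-elim (no-arc-into-root zr)
    retrace (px ◅ back) (inj₂ zx ◅ walk) with predecessor-unique px zx
    ... | refl = retrace back walk

  reachable : ∀ v → Reaches D root v
  reachable v = reverse id (retrace ε (connected root v))

  total : Total (Reaches D)
  total u v = comparable (reachable u) (reachable v)
    where
    comparable : ∀ {x u v} → Reaches D x u → Reaches D x v → Reaches D u v ⊎ Reaches D v u
    comparable ε        xv       = inj₁ xv
    comparable xu       ε        = inj₂ xu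
    comparable (xy ◅ yu) (xz ◅ zv) with successor-unique xy xz
    ... | refl = comparable yu zv

-- Transversals

maximum : ∀ {n ℓ} (_≼_ : Rel (Fin (suc n)) ℓ) → Total _≼_ → Transitive _≼_ → ∃ λ i → ∀ j → j ≼ i
maximum {zero}  _≼_ total trans = zero , λ { zero → reduce (total zero zero) }
maximum {suc n} _≼_ total trans
  with i , ≼i ← maximum (_≼_ on suc) (On.total suc _≼_ total) (On.transitive suc _≼_ trans)
  with total zero (suc i)
... | inj₁ 0≼i = suc i , λ { zero → 0≼i ; (suc j) → ≼i j }
... | inj₂ i≼0 = zero  , λ { zero → reduce (total zero zero) ; (suc j) → trans (≼i j) i≼0 }

record IsBijectionOntoAllBut {k} (r : Fin (suc k)) (t : Fin k → Fin (suc k)) : Set where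
  field
    injective : ∀ {c d} → t c ≡ t d → c ≡ d
    avoids    : ∀ c → t c ≢ r
    covers    : ∀ v → v ≢ r → ∃ λ c → t c ≡ v

punchIn-bijective : ∀ {k r} {t : Fin k → Fin (suc k)} i → IsBijectionOntoAllBut r t →
                    IsBijectionOntoAllBut (punchIn i r) (i Vector.∷ (punchIn i ∘ t))
punchIn-bijective {k} {r} {t} i bij = record
  { injective = injective′
  ; avoids    = avoids′
  ; covers    = covers′
  }
  where
  open IsBijectionOntoAllBut bij

  injective′ : ∀ {c d} → (i Vector.∷ (punchIn i ∘ t)) c ≡ (i Vector.∷ (punchIn i ∘ t)) d → c ≡ d
  injective′ {zero}  {zero}  _  = refl
  injective′ {zero}  {suc d} eq = ⊥-elim (punchInᵢ≢i i (t d) (sym eq))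
  injective′ {suc c} {zero}  eq = ⊥-elim (punchInᵢ≢i i (t c) eq)
  injective′ {suc c} {suc d} eq = cong suc (injective (punchIn-injective i _ _ eq))

  avoids′ : ∀ c → (i Vector.∷ (punchIn i ∘ t)) c ≢ punchIn i r
  avoids′ zero    eq = punchInᵢ≢i i r (sym eq)
  avoids′ (suc c) eq = avoids c (punchIn-injective i _ _ eq)

  covers′ : ∀ v → v ≢ punchIn i r → ∃ λ c → (i Vector.∷ (punchIn i ∘ t)) c ≡ v
  covers′ v v≢r with i ≟ v
  ... | yes refl = zero , refl
  ... | no i≢v   = suc c , trans (cong (punchIn i) tc≡v′) (punchIn-punchOut i≢v)
    where
    v′≢r : punchOut i≢v ≢ r
    v′≢r eq = v≢r (trans (sym (punchIn-punchOut i≢v)) (cong (punchIn i) eq))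

    c : Fin k
    c = proj₁ (covers (punchOut i≢v) v′≢r)

    tc≡v′ : t c ≡ punchOut i≢v
    tc≡v′ = proj₂ (covers (punchOut i≢v) v′≢r)

record Transversal {m ℓ} (_≼[_]_ : Fin (suc m) → Fin m → Fin (suc m) → Set ℓ) : Set ℓ where
  field
    root        : Fin (suc m)
    target      : Fin m → Fin (suc m)
    bijective   : IsBijectionOntoAllBut root target
    root≼target : ∀ c → root ≼[ c ] target c

transversal : ∀ {m ℓ} (_≼[_]_ : Fin (suc m) → Fin m → Fin (suc m) → Set ℓ) →
              (∀ c → Total (_≼[ c ]_)) → (∀ c → Transitive (_≼[ c ]_)) → Transversal _≼[_]_
transversal {zero} _ _ _ = record
  { root        = zero
  ; target      = λ ()
  ; bijective   = record { injective = λ { {()} } ; avoids = λ () ; covers = λ { zero 0≢0 → ⊥-elim (0≢0 refl) } }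
  ; root≼target = λ ()
  }
transversal {suc m} _≼[_]_ total trans = record
  { root        = punchIn i root
  ; target      = i Vector.∷ (punchIn i ∘ target)
  ; bijective   = punchIn-bijective i bijective
  ; root≼target = λ { zero → ≼i (punchIn i root) ; (suc c) → root≼target c }
  }
  where
  i : Fin (suc (suc m))
  i = proj₁ (maximum (_≼[ zero ]_) (total zero) (trans zero))

  ≼i : ∀ j → j ≼[ zero ] i
  ≼i = proj₂ (maximum (_≼[ zero ]_) (total zero) (trans zero))

  open Transversal (transversal (λ x c y → punchIn i x ≼[ suc c ] punchIn i y)
    (λ c → On.total (punchIn i) (_≼[ suc c ]_) (total (suc c)))
    (λ c → On.transitive (punchIn i) (_≼[ suc c ]_) (trans (suc c))))

-- Periodic points

module Iteration {A : Set} (f : A → A) where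

  open Function.Endo.Propositional A using (_^_; ^-homo) public

  ^-commute : ∀ m n x → (f ^ m) ((f ^ n) x) ≡ (f ^ n) ((f ^ m) x)
  ^-commute m n x = begin
    (f ^ m) ((f ^ n) x)  ≡⟨ cong-app (^-homo f m n) x ⟨
    (f ^ (m + n)) x      ≡⟨ cong (λ j → (f ^ j) x) (+-comm m n) ⟩
    (f ^ (n + m)) x      ≡⟨ cong-app (^-homo f n m) x ⟩
    (f ^ n) ((f ^ m) x)  ∎
    where open ≡-Reasoning

  ^-preserves : {P : Pred A 0ℓ} → (∀ {x} → P x → P (f x)) → ∀ n {x} → P x → P ((f ^ n) x)
  ^-preserves         P-closed zero    Px = Px
  ^-preserves {P = P} P-closed (suc n) Px = P-closed (^-preserves {P = P} P-closed n Px)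

  module PeriodicPoints (_≟_ : DecidableEquality A) (p : ℕ) {P : Pred A 0ℓ} (P? : Decidable P)
                        (P-closed : ∀ {x} → P x → P (f x)) where

    Periodic : Pred A 0ℓ
    Periodic x = P x × (f ^ suc p) x ≡ x

    periodic-closed : ∀ {x} → Periodic x → Periodic (f x)
    periodic-closed {x} (Px , fixed) = P-closed Px , trans (^-commute (suc p) 1 x) (cong f fixed)

    private
      unwind : ∀ {x} → Periodic x → (f ^ p) (f x) ≡ x
      unwind {x} (_ , fixed) = trans (^-commute p 1 x) fixed

    periodic-injective : ∀ {x y} → Periodic x → Periodic y → f x ≡ f y → x ≡ y
    periodic-injective {x} {y} px py fx≡fy = begin
      x              ≡⟨ unwind px ⟨
      (f ^ p) (f x)  ≡⟨ cong (f ^ p) fx≡fy ⟩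
      (f ^ p) (f y)  ≡⟨ unwind py ⟩
      y              ∎
      where open ≡-Reasoning

    periodic-surjective : ∀ {x} → Periodic x → ∃ λ y → Periodic y × f y ≡ x
    periodic-surjective {x} (Px , fixed) =
      (f ^ p) x , (^-preserves {P = P} P-closed p Px , trans (^-commute (suc p) p x) (cong (f ^ p) fixed)) , fixed

    periodic? : Decidable Periodic
    periodic? x = P? x ×-dec ((f ^ suc p) x ≟ x)

    rotate : A → A
    rotate x with periodic? x
    ... | yes _ = f x
    ... | no  _ = x

    rotate-periodic : ∀ {x} → Periodic x → rotate x ≡ f x
    rotate-periodic {x} px with periodic? x
    ... | yes _  = refl
    ... | no ¬px = ⊥-elim (¬px px)

    rotate-aperiodic : ∀ {x} → ¬ Periodic x → rotate x ≡ x
    rotate-aperiodic {x} ¬px with periodic? x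
    ... | yes px = ⊥-elim (¬px px)
    ... | no _   = refl

    rotate-injective : ∀ {x y} → rotate x ≡ rotate y → x ≡ y
    rotate-injective {x} {y} with periodic? x | periodic? y
    ... | yes px | yes py = periodic-injective px py
    ... | yes px | no ¬py = λ fx≡y → ⊥-elim (¬py (subst Periodic fx≡y (periodic-closed px)))
    ... | no ¬px | yes py = λ x≡fy → ⊥-elim (¬px (subst Periodic (sym x≡fy) (periodic-closed py)))
    ... | no _   | no _   = id

    rotate-surjective : ∀ y → ∃ λ x → rotate x ≡ y
    rotate-surjective y with periodic? y
    ... | no ¬py = y , rotate-aperiodic ¬py
    ... | yes py with x , px , fx≡y ← periodic-surjective py = x , trans (rotate-periodic px) fx≡y

module _ {k} (f : Fin k → Fin k) where

  open Iteration f

  periodic-point : ∀ x → ∃₂ λ i p → (f ^ suc p) ((f ^ i) x) ≡ (f ^ i) x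
  periodic-point x with i , j , i<j , fⁱx≡fʲx ← pigeonhole (n<1+n k) (λ j → (f ^ toℕ j) x)
                   with p , i+1+p≡j ← m≤n⇒∃[o]m+o≡n i<j =
    toℕ i , p , (begin
      (f ^ suc p) ((f ^ toℕ i) x)  ≡⟨ cong-app (^-homo f (suc p) (toℕ i)) x ⟨
      (f ^ (suc p + toℕ i)) x      ≡⟨ cong (λ j → (f ^ suc j) x) (+-comm p (toℕ i)) ⟩
      (f ^ (suc (toℕ i) + p)) x    ≡⟨ cong (λ j → (f ^ j) x) i+1+p≡j ⟩
      (f ^ toℕ j) x                ≡⟨ fⁱx≡fʲx ⟨
      (f ^ toℕ i) x                ∎)
    where open ≡-Reasoning

-- Rainbow trees

arcsOf : ∀ {k} → (Fin k → Fin (suc k)) → (Fin k → Fin (suc k)) → Digraph (suc k)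
arcsOf {k} parent target = map (λ c → parent c , target c) (allFin k)

record RainbowTree {k} (A : Fin k → Digraph (suc k)) (r : Fin (suc k)) : Set where
  field
    parent    : Fin k → Fin (suc k)
    target    : Fin k → Fin (suc k)
    bijective : IsBijectionOntoAllBut r target
    arc       : ∀ c → HasArc (A c) (parent c) (target c)
    reachable : ∀ c → Reaches (arcsOf parent target) r (target c)

module _ {k} {A : Fin k → Digraph (suc k)} {r} (tree : RainbowTree A r) where

  open RainbowTree tree
  open IsBijectionOntoAllBut bijective

  private
    arcOf : Fin k → Arc (suc k)
    arcOf c = parent c , target c

  arcsOf-spanning : IsSpanningArborescence (arcsOf parent target)
  arcsOf-spanning = connected , r , indeg-root , indeg-nonroot
    where
    reaches : ∀ v → Star (Adjacent (arcsOf parent target)) r v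
    reaches v with v ≟ r
    ... | yes refl = ε
    ... | no v≢r with c , refl ← covers v v≢r = Star.map inj₁ (reachable c)

    connected : Connected (arcsOf parent target)
    connected u v = reverse swap (reaches u) ◅◅ reaches v

    indeg-root : indeg (arcsOf parent target) r ≡ 0
    indeg-root = cong length (filter-none (λ a → proj₂ a ≟ r) (All.map⁺ (All.tabulate⁺ avoids)))

    indeg-nonroot : ∀ v → v ≢ r → indeg (arcsOf parent target) v ≡ 1
    indeg-nonroot v v≢r with c , tc≡v ← covers v v≢r =
      length-filter-unique (λ a → proj₂ a ≟ v) (UniqueProps.map⁺ arcOf-injective (allFin⁺ k))
        (∈-map⁺ arcOf (∈-allFin c)) tc≡v only-c
      where
      arcOf-injective : ∀ {c d} → arcOf c ≡ arcOf d → c ≡ d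
      arcOf-injective = injective ∘ cong proj₂

      only-c : ∀ {a} → a ∈ arcsOf parent target → proj₂ a ≡ v → a ≡ arcOf c
      only-c a∈ a↦v with d , _ , refl ← ∈-map⁻ arcOf a∈ = cong arcOf (injective (trans a↦v (sym tc≡v)))

  rainbowArborescence : ∃[ B ] (Subgraph A B × Rainbow B × IsSpanningArborescence (underlying B))
  rainbowArborescence = B , subgraph , rainbow , subst IsSpanningArborescence (map-∘ (allFin k)) arcsOf-spanning
    where
    B : List (Fin k × Arc (suc k))
    B = map (λ c → c , arcOf c) (allFin k)

    subgraph : Subgraph A B
    subgraph = All.map⁺ (All.tabulate⁺ arc)

    rainbow : Rainbow B
    rainbow = subst Unique (map-∘ (allFin k)) (UniqueProps.map⁺ {f = id} id (allFin⁺ k))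

-- Growing a rainbow tree

data Walk {A : Set} (R : Rel A 0ℓ) : ℕ → A → A → Set where
  []  : ∀ {x} → Walk R 0 x x
  _▸_ : ∀ {n x y z} → Walk R n x y → R y z → Walk R (suc n) x z

module _ {A : Set} {R : Rel A 0ℓ} where

  _◂_ : ∀ {n x y z} → R x y → Walk R n y z → Walk R (suc n) x z
  xy ◂ []      = [] ▸ xy
  xy ◂ (w ▸ a) = (xy ◂ w) ▸ a

  fromStar : ∀ {x y} → Star R x y → ∃ λ n → Walk R n x y
  fromStar ε        = 0 , []
  fromStar (xy ◅ w) = _ , xy ◂ proj₂ (fromStar w)

module Augmentation {k} (A : Fin k → Digraph (suc k)) (r : Fin (suc k)) where

  data Status : Set where
    attached : (parent : Fin (suc k)) → Status
    pending  : (length : ℕ) → Status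

  weight : Status → ℕ
  weight (attached _) = 0
  weight (pending n)  = n

  record State : Set where
    field
      target : Fin k → Fin (suc k)
      status : Fin k → Status

  open State

  module _ (st : State) where

    Attached : Fin k → Set
    Attached c = ∃ λ p → status st c ≡ attached p

    Pending : Fin k → Set
    Pending c = ∃ λ n → status st c ≡ pending n

    pending? : Decidable Pending
    pending? c with status st c
    ... | attached _ = no λ ()
    ... | pending n  = yes (n , refl)

    InTree : Fin (suc k) → Set
    InTree v = v ≡ r ⊎ ∃ λ c → Attached c × target st c ≡ v

    inTree? : Decidable InTree
    inTree? v = (v ≟ r) ⊎-dec any? (λ c → attached? c ×-dec (target st c ≟ v))
      where
      attached? : Decidable Attached
      attached? c with status st c
      ... | attached p = yes (p , refl)
      ... | pending _  = no λ ()

    TreeArc : Rel (Fin (suc k)) 0ℓ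
    TreeArc x y = ∃ λ c → status st c ≡ attached x × target st c ≡ y

    measure : ℕ
    measure = ∑ (weight ∘ status st)

  record Invariant (st : State) : Set where
    field
      bijective : IsBijectionOntoAllBut r (target st)
      tree-arc  : ∀ {c p} → status st c ≡ attached p → HasArc (A c) p (target st c)
      tree-path : ∀ {c p} → status st c ≡ attached p → Star (TreeArc st) r (target st c)
      walk      : ∀ {c n} → status st c ≡ pending n →
                  ∃ λ s → InTree st s × Walk (HasArc (A c)) n s (target st c)

    open IsBijectionOntoAllBut bijective

    inTree-path : ∀ {v} → InTree st v → Star (TreeArc st) r v
    inTree-path (inj₁ refl)                = ε
    inTree-path (inj₂ (c , (_ , eq) , refl)) = tree-path eq

    pending∉tree : ∀ {c n} → status st c ≡ pending n → ¬ InTree st (target st c)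
    pending∉tree eq (inj₁ tc≡r) = avoids _ tc≡r
    pending∉tree eq (inj₂ (d , (_ , eq′) , td≡tc)) with injective td≡tc
    ... | refl with () ← trans (sym eq′) eq

    pending-positive : ∀ {c n} → status st c ≡ pending n → 0 < n
    pending-positive eq with walk eq
    ... | _ , s∈tree , []    = ⊥-elim (pending∉tree eq s∈tree)
    ... | _ , _      , _ ▸ _ = s≤s z≤n

  KeepsTree : State → State → Set
  KeepsTree st st′ = ∀ {c p} → status st c ≡ attached p → status st′ c ≡ attached p × target st′ c ≡ target st c

  module _ {st st′ : State} (keeps : KeepsTree st st′) where

    inTree-mono : ∀ {v} → InTree st v → InTree st′ v
    inTree-mono (inj₁ v≡r)                     = inj₁ v≡r
    inTree-mono (inj₂ (c , (p , eq) , tc≡v)) with eq′ , tc′≡tc ← keeps eq = inj₂ (c , (p , eq′) , trans tc′≡tc tc≡v)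

    treeArc-mono : ∀ {x y} → TreeArc st x y → TreeArc st′ x y
    treeArc-mono (c , eq , tc≡y) with eq′ , tc′≡tc ← keeps eq = c , eq′ , trans tc′≡tc tc≡y

  attach : ∀ {st} → Invariant st → ∀ {c n y} → status st c ≡ pending n → InTree st y →
           HasArc (A c) y (target st c) → ∃ λ st′ → Invariant st′ × measure st′ < measure st
  attach {st} inv {c} {n} {y} c-pending y∈tree y→c = st′ , invariant′ , decreases
    where
    open Invariant inv

    st′ : State
    st′ = record st { status = updateAt (status st) c (λ _ → attached y) }

    status′-view : ∀ {d s} → status st′ d ≡ s → (d ≡ c × s ≡ attached y) ⊎ status st d ≡ s
    status′-view {d} eq with d ≟ c
    ... | yes refl = inj₁ (refl , trans (sym eq) (updateAt-updates c {λ _ → attached y} (status st)))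
    ... | no d≢c   = inj₂ (trans (sym (updateAt-minimal d c {λ _ → attached y} (status st) d≢c)) eq)

    keeps : KeepsTree st st′
    keeps {d} eq with d ≟ c
    ... | yes refl with () ← trans (sym eq) c-pending
    ... | no d≢c   = trans (updateAt-minimal d c {λ _ → attached y} (status st) d≢c) eq , refl

    tree-arc′ : ∀ {d p} → status st′ d ≡ attached p → HasArc (A d) p (target st d)
    tree-arc′ eq with status′-view eq
    ... | inj₁ (refl , refl) = y→c
    ... | inj₂ eq′           = tree-arc eq′

    tree-path′ : ∀ {d p} → status st′ d ≡ attached p → Star (TreeArc st′) r (target st d)
    tree-path′ eq with status′-view eq
    ... | inj₁ (refl , refl) = Star.map (treeArc-mono keeps) (inTree-path y∈tree)
                                 ◅◅ ((c , updateAt-updates c {λ _ → attached y} (status st) , refl) ◅ ε)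
    ... | inj₂ eq′           = Star.map (treeArc-mono keeps) (tree-path eq′)

    walk′ : ∀ {d m} → status st′ d ≡ pending m →
            ∃ λ s → InTree st′ s × Walk (HasArc (A d)) m s (target st d)
    walk′ eq with status′-view eq
    ... | inj₁ (_ , ())
    ... | inj₂ eq′ with s , s∈tree , w ← walk eq′ = s , inTree-mono keeps s∈tree , w

    invariant′ : Invariant st′
    invariant′ = record { bijective = bijective ; tree-arc = tree-arc′ ; tree-path = tree-path′ ; walk = walk′ }

    decreases : measure st′ < measure st
    decreases = ∑-mono-< weight′≤weight c weight′<weight
      where
      weight′≤weight : ∀ d → weight (status st′ d) ≤ weight (status st d)
      weight′≤weight d with status′-view {d} refl
      ... | inj₁ (_ , eq) rewrite eq = z≤n
      ... | inj₂ eq                  = ≤-reflexive (cong weight (sym eq))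

      weight′<weight : weight (status st′ c) < weight (status st c)
      weight′<weight rewrite updateAt-updates c {λ _ → attached y} (status st) | c-pending = pending-positive c-pending

  Stuck : State → Set
  Stuck st = ∀ {c n y} → status st c ≡ pending n → InTree st y → ¬ HasArc (A c) y (target st c)

  module Rotation {st} (inv : Invariant st) (stuck : Stuck st) where

    open Invariant inv
    open IsBijectionOntoAllBut bijective

    record Redirect (c c′ : Fin k) : Set where
      field
        remaining     : ℕ
        c-pending     : status st c ≡ pending (suc remaining)
        c′-pending    : Pending st c′
        start         : Fin (suc k)
        start-in-tree : InTree st start
        shorter-walk  : Walk (HasArc (A c)) remaining start (target st c′)

    -- The walk is nonempty as its target is outside the tree, and its last arc starts outside
    -- the tree since st is stuck, hence at the target of a colour that is not attached.
    redirect : ∀ {c} → Pending st c → ∃ (Redirect c)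
    redirect (n , c-pending) with walk c-pending
    ... | s , s∈tree , [] = ⊥-elim (pending∉tree c-pending s∈tree)
    ... | s , s∈tree , _▸_ {y = y} w y→c with inTree? st y
    ...   | yes y∈tree = ⊥-elim (stuck c-pending y∈tree y→c)
    ...   | no  y∉tree with c′ , tc′≡y ← covers y (y∉tree ∘ inj₁) with status st c′ in c′-status
    ...     | attached p = ⊥-elim (y∉tree (inj₂ (c′ , (p , c′-status) , tc′≡y)))
    ...     | pending m  = c′ , record
      { remaining = _ ; c-pending = c-pending ; c′-pending = m , c′-status
      ; start = s ; start-in-tree = s∈tree ; shorter-walk = subst (Walk _ _ s) (sym tc′≡y) w }

    next : Fin k → Fin k
    next c with pending? st c
    ... | yes pc = proj₁ (redirect pc)
    ... | no  _  = c

    next-redirect : ∀ {c} → Pending st c → Redirect c (next c)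
    next-redirect {c} pc with pending? st c
    ... | yes pc′ = proj₂ (redirect pc′)
    ... | no ¬pc  = ⊥-elim (¬pc pc)

    next-pending : ∀ {c} → Pending st c → Pending st (next c)
    next-pending pc = Redirect.c′-pending (next-redirect pc)

    open Iteration next

    module _ {c₀} (c₀-pending : Pending st c₀) where

      private
        i p : ℕ
        i = proj₁ (periodic-point next c₀)
        p = proj₁ (proj₂ (periodic-point next c₀))

      open PeriodicPoints _≟_ p (pending? st) next-pending

      status′ : ∀ c → Dec (Periodic c) → Status
      status′ c (yes (pc , _)) = pending (Redirect.remaining (next-redirect pc))
      status′ c (no _)         = status st c

      st′ : State
      st′ = record { target = target st ∘ rotate ; status = λ c → status′ c (periodic? c) }

      status′-view : ∀ c → (∃ λ (pc : Periodic c) → status st′ c ≡ pending (Redirect.remaining (next-redirect (proj₁ pc))))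
                         ⊎ (¬ Periodic c × status st′ c ≡ status st c)
      status′-view c with periodic? c
      ... | yes pc  = inj₁ (pc , refl)
      ... | no ¬pc  = inj₂ (¬pc , refl)

      keeps : KeepsTree st st′
      keeps {c} eq with status′-view c
      ... | inj₁ (((_ , pending-eq) , _) , _) with () ← trans (sym eq) pending-eq
      ... | inj₂ (¬pc , eq′) = trans eq′ eq , cong (target st) (rotate-aperiodic ¬pc)

      attached-unchanged : ∀ {c p} → status st′ c ≡ attached p → status st c ≡ attached p × target st′ c ≡ target st c
      attached-unchanged {c} eq with status′-view c
      ... | inj₁ (_ , eq′)   with () ← trans (sym eq) eq′
      ... | inj₂ (¬pc , eq′) = trans (sym eq′) eq , cong (target st) (rotate-aperiodic ¬pc)

      invariant′ : Invariant st′
      invariant′ = record { bijective = bijective′ ; tree-arc = tree-arc′ ; tree-path = tree-path′ ; walk = walk′ }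
        where
        bijective′ : IsBijectionOntoAllBut r (target st ∘ rotate)
        bijective′ = record
          { injective = rotate-injective ∘ injective
          ; avoids    = avoids ∘ rotate
          ; covers    = λ v v≢r → let c , tc≡v = covers v v≢r ; d , rd≡c = rotate-surjective c
                                  in d , trans (cong (target st) rd≡c) tc≡v
          }

        tree-arc′ : ∀ {c p} → status st′ c ≡ attached p → HasArc (A c) p (target st′ c)
        tree-arc′ eq with eq′ , tc′≡tc ← attached-unchanged eq = subst (HasArc (A _) _) (sym tc′≡tc) (tree-arc eq′)

        tree-path′ : ∀ {c p} → status st′ c ≡ attached p → Star (TreeArc st′) r (target st′ c)
        tree-path′ eq with eq′ , tc′≡tc ← attached-unchanged eq =
          subst (Star (TreeArc st′) r) (sym tc′≡tc) (Star.map (treeArc-mono keeps) (tree-path eq′))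

        walk′ : ∀ {c n} → status st′ c ≡ pending n →
                ∃ λ s → InTree st′ s × Walk (HasArc (A c)) n s (target st′ c)
        walk′ {c} eq with status′-view c
        ... | inj₁ (pc , eq′) with refl ← trans (sym eq) eq′ =
          let open Redirect (next-redirect (proj₁ pc))
          in start , inTree-mono keeps start-in-tree ,
             subst (Walk _ _ start) (sym (cong (target st) (rotate-periodic pc))) shorter-walk
        ... | inj₂ (¬pc , eq′) with s , s∈tree , w ← walk (trans (sym eq′) eq) =
          s , inTree-mono keeps s∈tree , subst (Walk _ _ s) (sym (cong (target st) (rotate-aperiodic ¬pc))) w

      weight′<weight : ∀ {c} → Periodic c → weight (status st′ c) < weight (status st c)
      weight′<weight {c} pc with status′-view c
      ... | inj₁ (pc′ , eq′) = subst₂ _<_ (cong weight (sym eq′))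
                                 (cong weight (sym (Redirect.c-pending (next-redirect (proj₁ pc′))))) (n<1+n _)
      ... | inj₂ (¬pc , _)   = ⊥-elim (¬pc pc)

      weight′≤weight : ∀ c → weight (status st′ c) ≤ weight (status st c)
      weight′≤weight c with status′-view c
      ... | inj₁ (pc , _)  = <⇒≤ (weight′<weight pc)
      ... | inj₂ (_ , eq′) = ≤-reflexive (cong weight eq′)

      rotation : ∃ λ st′ → Invariant st′ × measure st′ < measure st
      rotation = st′ , invariant′ , ∑-mono-< weight′≤weight ((next ^ i) c₀) (weight′<weight periodic)
        where
        periodic : Periodic ((next ^ i) c₀)
        periodic = ^-preserves {P = Pending st} next-pending i c₀-pending
                 , proj₂ (proj₂ (periodic-point next c₀))

  Attachable : State → Fin k → Set
  Attachable st c = Pending st c × ∃ λ y → InTree st y × HasArc (A c) y (target st c)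

  attachable? : ∀ st → Decidable (Attachable st)
  attachable? st c = pending? st c ×-dec any? (λ y → inTree? st y ×-dec ((y , target st c) ∈? A c))
    where open import Data.List.Membership.DecPropositional (≡-dec _≟_ _≟_) using (_∈?_)

  finish : ∀ {st} → Invariant st → (∀ c → ¬ Pending st c) → RainbowTree A r
  finish {st} inv none-pending = record
    { parent    = parent
    ; target    = target st
    ; bijective = bijective
    ; arc       = λ c → tree-arc (proj₂ (all-attached c))
    ; reachable = λ c → Star.map treeArc⇒arc (tree-path (proj₂ (all-attached c)))
    }
    where
    open Invariant inv

    all-attached : ∀ c → Attached st c
    all-attached c with status st c in eq
    ... | attached p = p , refl
    ... | pending n  = ⊥-elim (none-pending c (n , eq))

    parent : Fin k → Fin (suc k)
    parent c = proj₁ (all-attached c)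

    treeArc⇒arc : ∀ {x y} → TreeArc st x y → HasArc (arcsOf parent (target st)) x y
    treeArc⇒arc (c , eq , refl) with refl ← trans (sym (proj₂ (all-attached c))) eq =
      ∈-map⁺ (λ c → parent c , target st c) (∈-allFin c)

  progress : ∀ {st} → Invariant st → ∃ (Pending st) → ∃ λ st′ → Invariant st′ × measure st′ < measure st
  progress {st} inv (c₀ , c₀-pending) with any? (attachable? st)
  ... | yes (_ , (_ , c-pending) , _ , y∈tree , y→c) = attach inv c-pending y∈tree y→c
  ... | no none-attachable = Rotation.rotation inv stuck c₀-pending
    where
    stuck : Stuck st
    stuck c-pending y∈tree y→c = none-attachable (_ , (_ , c-pending) , _ , y∈tree , y→c)

  augment : ∀ st → Invariant st → Acc _<_ (measure st) → RainbowTree A r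
  augment st inv (acc smaller) with any? (pending? st)
  ... | no none-pending = finish inv (λ c pc → none-pending (c , pc))
  ... | yes some-pending with st′ , inv′ , st′<st ← progress inv some-pending = augment st′ inv′ (smaller st′<st)

  rainbowTree : ∀ {t} → IsBijectionOntoAllBut r t → (∀ c → Reaches (A c) r (t c)) → RainbowTree A r
  rainbowTree {t} bijective reaches = augment initial invariant (<-wellFounded (measure initial))
    where
    initial : State
    initial = record { target = t ; status = λ c → pending (proj₁ (fromStar (reaches c))) }

    invariant : Invariant initial
    invariant = record
      { bijective = bijective
      ; tree-arc  = λ ()
      ; tree-path = λ ()
      ; walk      = λ { {c} refl → r , inj₁ refl , proj₂ (fromStar (reaches c)) }
      }

theorem3p3 : (n : ℕ) → 2 ≤ n → (A : Fin (n ∸ 1) → Digraph n) →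
    (∀ i → IsSpanningArborescence (A i) × IsPath (A i)) →
    ∃[ B ] (Subgraph A B × Rainbow B × IsSpanningArborescence (underlying B))
theorem3p3 zero    ()
theorem3p3 (suc k) _  A paths = rainbowArborescence (Augmentation.rainbowTree A root bijective root≼target)
  where
  path-total : ∀ c → Total (Reaches (A c))
  path-total c = PathArborescence.total (proj₁ (paths c)) (proj₂ (paths c))

  open Transversal (transversal (λ x c → Reaches (A c) x) path-total (λ _ → _◅◅_))
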